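{- Let $S\subseteq\mathbb{F}_2^n$ have $|S|=k$ and $\dim S=k-3$, and let $a\le b\le c$ be the cardinalities of the Venn regions of $S$ with respect to $E(S)$ other than the isolated point set. Then $S$ is a cap if and only if $a+b$, $b+c$ and $a+c$ are all at least $6$.
   Context: The dimension of $S$ is that of its affine span. A cap (quad cap, Sidon set) is a subset of $\mathbb{F}_2^n$ containing no four distinct elements summing to $\vec 0$. $E(S)$ is the $\mathbb{F}_2$-subspace (under symmetric difference) of $\mathcal{P}(S)$ consisting of even-size subsets of $S$ whose elements sum to $\vec 0$ (including $\varnothing$); here $\dim E(S)=2$. For a basis $(X_1,X_2)$ of $E(S)$ the Venn regions are $X_1\cap X_2$, $X_1\setminus X_2$, $X_2\setminus X_1$, and the isolated point set $S\setminus(X_1\cup X_2)$; the first three have cardinalities $a\le b\le c$ after sorting. -}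

module Defs where

open import Data.Nat using (ℕ; zero; suc; _+_; _≤_)
open import Data.Nat.Divisibility using (_∣_)
open import Data.Bool using (Bool; true; false; _xor_; if_then_else_)
open import Data.Fin using (Fin; zero; suc)
open import Data.Vec using (Vec; []; _∷_; replicate; zipWith)
open import Data.Fin.Subset using (Subset; ⊥; _⊆_; ∣_∣)
open import Data.Product using (Σ; _×_; _,_)
open import Data.Sum using (_⊎_)
open import Relation.Binary.PropositionalEquality using (_≡_; _≢_)
open import Function.Definitions using (Injective)

F2^ : ℕ → Set
F2^ n = Vec Bool n

𝟎 : ∀ {n} → F2^ n
𝟎 = replicate _ false

infixl 6 _⊕_
_⊕_ : ∀ {n} → F2^ n → F2^ n → F2^ n
_⊕_ = zipWith _xor_

-- A finite set S ⊆ F₂ⁿ with |S| = k is given as an injective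
-- enumeration  S : Fin k → F2^ n.  Subsets of S are  Subset k.

sumOver : ∀ {n k} → (Fin k → F2^ n) → Subset k → F2^ n
sumOver {k = zero}  S []      = 𝟎
sumOver {k = suc k} S (b ∷ X) =
  (if b then S zero else 𝟎) ⊕ sumOver (λ i → S (suc i)) X

_△_ : ∀ {k} → Subset k → Subset k → Subset k
_△_ = zipWith _xor_

InE : ∀ {n k} → (Fin k → F2^ n) → Subset k → Set
InE S X = (2 ∣ ∣ X ∣) × (sumOver S X ≡ 𝟎)

IsBasisE : ∀ {n k} → (Fin k → F2^ n) → Subset k → Subset k → Set
IsBasisE S X₁ X₂ =
  InE S X₁ × InE S X₂ ×
  X₁ ≢ ⊥ × X₂ ≢ ⊥ × (X₁ △ X₂) ≢ ⊥ ×
  (∀ X → InE S X → X ≡ ⊥ ⊎ X ≡ X₁ ⊎ X ≡ X₂ ⊎ X ≡ (X₁ △ X₂))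

-- Affine independence of the points of S indexed by T (over F₂):
-- no nontrivial affine dependence Σ cᵢ sᵢ = 0 with Σ cᵢ = 0, i.e. no
-- nonempty subset U ⊆ T of even size whose elements sum to 0.
AffIndep : ∀ {n k} → (Fin k → F2^ n) → Subset k → Set
AffIndep S T = ∀ U → U ⊆ T → 2 ∣ ∣ U ∣ → sumOver S U ≡ 𝟎 → U ≡ ⊥

-- The affine span of S has dimension d: the maximal size of an
-- affinely independent subset of S is d + 1.
AffDim : ∀ {n k} → (Fin k → F2^ n) → ℕ → Set
AffDim S d =
  Σ _ (λ T → AffIndep S T × ∣ T ∣ ≡ suc d) ×
  (∀ T → AffIndep S T → ∣ T ∣ ≤ suc d)

IsCap : ∀ {n k} → (Fin k → F2^ n) → Set
IsCap S = ∀ i j l m → i ≢ j → i ≢ l → i ≢ m → j ≢ l → j ≢ m → l ≢ m →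
  S i ⊕ S j ⊕ S l ⊕ S m ≢ 𝟎

{-# OPTIONS --safe #-}
-- An injective S never has two points summing to 𝟎, so S is a cap exactly when no
-- even subset of size 0 < m < 6 sums to 𝟎, i.e. when every nonzero member of E(S) has
-- at least six points. The nonzero members of E(S) are X₁, X₂ and X₁ △ X₂, whose sizes
-- are a + b, a + c and b + c in terms of the Venn regions.
module Submission where

open import Defs
open import Data.Nat using (ℕ; _+_; _*_; _≤_; zero; suc)
open import Data.Nat.Properties using (+-suc; 0≢1+n; ≤⇒≯; n≤1+n; m≤m+n)
open import Data.Nat.Divisibility using (_∣_; divides; ∣m∣n⇒∣m+n; ∣m+n∣m⇒∣n; m∣m*n)
open import Data.Nat.Tactic.RingSolver using (solve-∀)
open import Data.Bool using (true; false; _xor_; if_then_else_)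
open import Data.Bool.Properties using (xor-assoc; xor-comm; xor-identityˡ; xor-identityʳ; xor-same)
open import Data.Fin using (Fin; zero; suc)
open import Data.Fin.Properties using (suc-injective)
open import Data.Fin.Subset using (Subset; ∣_∣; _∩_; _─_; ⊥; ⁅_⁆; _∈_; _∉_; inside; outside)
open import Data.Fin.Subset.Properties using (∣⊥∣≡0; ∉⊥; ∩-comm)
open import Data.Vec using (Vec; []; _∷_; map; foldr′; here; there)
open import Data.Vec.Properties using (zipWith-assoc; zipWith-comm; zipWith-identityˡ; zipWith-identityʳ)
open import Data.Vec.Relation.Unary.All using (All; []; _∷_; universal)
import Data.Vec.Relation.Unary.All.Properties as All
open import Data.Vec.Relation.Unary.AllPairs using ([]; _∷_)
open import Data.Vec.Relation.Unary.Unique.Propositional using (Unique)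
import Data.Vec.Relation.Unary.Unique.Propositional.Properties as Unique
open import Data.Product using (_×_; _,_; Σ-syntax)
open import Data.Sum using (_⊎_; inj₁; inj₂)
open import Function using (_∘_)
open import Function.Bundles using (Equivalence; _⇔_; mk⇔)
open import Function.Construct.Composition using (_⇔-∘_)
open import Function.Definitions using (Injective)
open import Relation.Binary.PropositionalEquality
  using (_≡_; _≢_; refl; sym; trans; cong; cong₂; subst; module ≡-Reasoning)
open import Relation.Nullary using (contradiction)

private
  variable
    n k m : ℕ

⊕-assoc : (x y z : F2^ n) → (x ⊕ y) ⊕ z ≡ x ⊕ (y ⊕ z)
⊕-assoc = zipWith-assoc xor-assoc

⊕-comm : (x y : F2^ n) → x ⊕ y ≡ y ⊕ x
⊕-comm = zipWith-comm xor-comm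

⊕-identityˡ : (x : F2^ n) → 𝟎 ⊕ x ≡ x
⊕-identityˡ = zipWith-identityˡ xor-identityˡ

⊕-identityʳ : (x : F2^ n) → x ⊕ 𝟎 ≡ x
⊕-identityʳ = zipWith-identityʳ xor-identityʳ

x⊕x≡𝟎 : (x : F2^ n) → x ⊕ x ≡ 𝟎
x⊕x≡𝟎 []      = refl
x⊕x≡𝟎 (a ∷ x) = cong₂ _∷_ (xor-same a) (x⊕x≡𝟎 x)

x⊕y≡𝟎⇒x≡y : (x y : F2^ n) → x ⊕ y ≡ 𝟎 → x ≡ y
x⊕y≡𝟎⇒x≡y x y x⊕y≡𝟎 = begin
  x           ≡⟨ sym (⊕-identityʳ x) ⟩
  x ⊕ 𝟎       ≡⟨ cong (x ⊕_) (sym (x⊕x≡𝟎 y)) ⟩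
  x ⊕ (y ⊕ y) ≡⟨ sym (⊕-assoc x y y) ⟩
  (x ⊕ y) ⊕ y ≡⟨ cong (_⊕ y) x⊕y≡𝟎 ⟩
  𝟎 ⊕ y       ≡⟨ ⊕-identityˡ y ⟩
  y           ∎
  where open ≡-Reasoning

⊕-interchange : (w x y z : F2^ n) → (w ⊕ x) ⊕ (y ⊕ z) ≡ (w ⊕ y) ⊕ (x ⊕ z)
⊕-interchange w x y z = begin
  (w ⊕ x) ⊕ (y ⊕ z) ≡⟨ ⊕-assoc w x (y ⊕ z) ⟩
  w ⊕ (x ⊕ (y ⊕ z)) ≡⟨ cong (w ⊕_) (sym (⊕-assoc x y z)) ⟩
  w ⊕ ((x ⊕ y) ⊕ z) ≡⟨ cong (λ t → w ⊕ (t ⊕ z)) (⊕-comm x y) ⟩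
  w ⊕ ((y ⊕ x) ⊕ z) ≡⟨ cong (w ⊕_) (⊕-assoc y x z) ⟩
  w ⊕ (y ⊕ (x ⊕ z)) ≡⟨ sym (⊕-assoc w y (x ⊕ z)) ⟩
  (w ⊕ y) ⊕ (x ⊕ z) ∎
  where open ≡-Reasoning

sumOver-⊥ : (S : Fin k → F2^ n) → sumOver S ⊥ ≡ 𝟎
sumOver-⊥ {k = zero}  S = refl
sumOver-⊥ {k = suc k} S = trans (⊕-identityˡ _) (sumOver-⊥ (S ∘ suc))

sumOver-△ : (S : Fin k → F2^ n) (p q : Subset k) →
            sumOver S (p △ q) ≡ sumOver S p ⊕ sumOver S q
sumOver-△ S []      []      = sym (⊕-identityˡ 𝟎)
sumOver-△ S (a ∷ p) (b ∷ q) =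
  trans (cong₂ _⊕_ (if-xor a b) (sumOver-△ (S ∘ suc) p q)) (⊕-interchange _ _ _ _)
  where
  if-xor : ∀ a b → (if a xor b then S zero else 𝟎) ≡
                   (if a then S zero else 𝟎) ⊕ (if b then S zero else 𝟎)
  if-xor false false = sym (⊕-identityˡ 𝟎)
  if-xor false true  = sym (⊕-identityˡ (S zero))
  if-xor true  false = sym (⊕-identityʳ (S zero))
  if-xor true  true  = sym (x⊕x≡𝟎 (S zero))

sumOver-⁅⁆ : (S : Fin k → F2^ n) (i : Fin k) → sumOver S ⁅ i ⁆ ≡ S i
sumOver-⁅⁆ S zero    = trans (cong (S zero ⊕_) (sumOver-⊥ (S ∘ suc))) (⊕-identityʳ (S zero))
sumOver-⁅⁆ S (suc i) = trans (⊕-identityˡ _) (sumOver-⁅⁆ (S ∘ suc) i)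

sumOver-⁅⁆△ : (S : Fin k → F2^ n) (i : Fin k) (p : Subset k) →
              sumOver S (⁅ i ⁆ △ p) ≡ S i ⊕ sumOver S p
sumOver-⁅⁆△ S i p = trans (sumOver-△ S ⁅ i ⁆ p) (cong (_⊕ sumOver S p) (sumOver-⁅⁆ S i))

△-identityˡ : (p : Subset k) → ⊥ △ p ≡ p
△-identityˡ = ⊕-identityˡ

∣p∣≡0⇒p≡⊥ : (p : Subset k) → ∣ p ∣ ≡ 0 → p ≡ ⊥
∣p∣≡0⇒p≡⊥ []            _ = refl
∣p∣≡0⇒p≡⊥ (outside ∷ p) e = cong (outside ∷_) (∣p∣≡0⇒p≡⊥ p e)

∣p∣≡∣p∩q∣+∣p─q∣ : (p q : Subset k) → ∣ p ∣ ≡ ∣ p ∩ q ∣ + ∣ p ─ q ∣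
∣p∣≡∣p∩q∣+∣p─q∣ []            []            = refl
∣p∣≡∣p∩q∣+∣p─q∣ (inside  ∷ p) (inside  ∷ q) = cong suc (∣p∣≡∣p∩q∣+∣p─q∣ p q)
∣p∣≡∣p∩q∣+∣p─q∣ (inside  ∷ p) (outside ∷ q) =
  trans (cong suc (∣p∣≡∣p∩q∣+∣p─q∣ p q)) (sym (+-suc _ _))
∣p∣≡∣p∩q∣+∣p─q∣ (outside ∷ p) (inside  ∷ q) = ∣p∣≡∣p∩q∣+∣p─q∣ p q
∣p∣≡∣p∩q∣+∣p─q∣ (outside ∷ p) (outside ∷ q) = ∣p∣≡∣p∩q∣+∣p─q∣ p q

∣q∣≡∣p∩q∣+∣q─p∣ : (p q : Subset k) → ∣ q ∣ ≡ ∣ p ∩ q ∣ + ∣ q ─ p ∣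
∣q∣≡∣p∩q∣+∣q─p∣ p q = trans (∣p∣≡∣p∩q∣+∣p─q∣ q p) (cong (λ r → ∣ r ∣ + ∣ q ─ p ∣) (∩-comm q p))

∣p△q∣≡∣p─q∣+∣q─p∣ : (p q : Subset k) → ∣ p △ q ∣ ≡ ∣ p ─ q ∣ + ∣ q ─ p ∣
∣p△q∣≡∣p─q∣+∣q─p∣ []            []            = refl
∣p△q∣≡∣p─q∣+∣q─p∣ (inside  ∷ p) (inside  ∷ q) = ∣p△q∣≡∣p─q∣+∣q─p∣ p q
∣p△q∣≡∣p─q∣+∣q─p∣ (inside  ∷ p) (outside ∷ q) = cong suc (∣p△q∣≡∣p─q∣+∣q─p∣ p q)
∣p△q∣≡∣p─q∣+∣q─p∣ (outside ∷ p) (inside  ∷ q) =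
  trans (cong suc (∣p△q∣≡∣p─q∣+∣q─p∣ p q)) (sym (+-suc _ _))
∣p△q∣≡∣p─q∣+∣q─p∣ (outside ∷ p) (outside ∷ q) = ∣p△q∣≡∣p─q∣+∣q─p∣ p q

∣p∣+∣q∣≡2∣p∩q∣+∣p△q∣ : (p q : Subset k) → ∣ p ∣ + ∣ q ∣ ≡ 2 * ∣ p ∩ q ∣ + ∣ p △ q ∣
∣p∣+∣q∣≡2∣p∩q∣+∣p△q∣ p q = begin
  ∣ p ∣ + ∣ q ∣
    ≡⟨ cong₂ _+_ (∣p∣≡∣p∩q∣+∣p─q∣ p q) (∣q∣≡∣p∩q∣+∣q─p∣ p q) ⟩
  (∣ p ∩ q ∣ + ∣ p ─ q ∣) + (∣ p ∩ q ∣ + ∣ q ─ p ∣)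
    ≡⟨ regroup (∣ p ∩ q ∣) (∣ p ─ q ∣) (∣ q ─ p ∣) ⟩
  2 * ∣ p ∩ q ∣ + (∣ p ─ q ∣ + ∣ q ─ p ∣)
    ≡⟨ cong (2 * ∣ p ∩ q ∣ +_) (sym (∣p△q∣≡∣p─q∣+∣q─p∣ p q)) ⟩
  2 * ∣ p ∩ q ∣ + ∣ p △ q ∣
    ∎
  where
  open ≡-Reasoning
  regroup : ∀ a b c → (a + b) + (a + c) ≡ 2 * a + (b + c)
  regroup = solve-∀

InE-△ : (S : Fin k → F2^ n) {p q : Subset k} → InE S p → InE S q → InE S (p △ q)
InE-△ S {p} {q} (2∣∣p∣ , Σp≡𝟎) (2∣∣q∣ , Σq≡𝟎) = 2∣∣p△q∣ , Σp△q≡𝟎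
  where
  2∣∣p△q∣ : 2 ∣ ∣ p △ q ∣
  2∣∣p△q∣ = ∣m+n∣m⇒∣n (subst (2 ∣_) (∣p∣+∣q∣≡2∣p∩q∣+∣p△q∣ p q) (∣m∣n⇒∣m+n 2∣∣p∣ 2∣∣q∣))
                      (m∣m*n ∣ p ∩ q ∣)
  Σp△q≡𝟎 : sumOver S (p △ q) ≡ 𝟎
  Σp△q≡𝟎 = trans (sumOver-△ S p q) (trans (cong₂ _⊕_ Σp≡𝟎 Σq≡𝟎) (⊕-identityˡ 𝟎))

-- Entries occurring twice cancel; for a Unique vector this is its set of entries.
toSubset : Vec (Fin k) m → Subset k
toSubset []       = ⊥
toSubset (i ∷ is) = ⁅ i ⁆ △ toSubset is

toSubset-map-suc : (is : Vec (Fin k) m) → toSubset (map suc is) ≡ outside ∷ toSubset is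
toSubset-map-suc []       = refl
toSubset-map-suc (i ∷ is) = cong (⁅ suc i ⁆ △_) (toSubset-map-suc is)

sumOver-toSubset : (S : Fin k → F2^ n) (is : Vec (Fin k) m) →
                   sumOver S (toSubset is) ≡ foldr′ _⊕_ 𝟎 (map S is)
sumOver-toSubset S []       = sumOver-⊥ S
sumOver-toSubset S (i ∷ is) =
  trans (sumOver-⁅⁆△ S i (toSubset is)) (cong (S i ⊕_) (sumOver-toSubset S is))

∈-⁅⁆△⁻ : {i j : Fin k} (p : Subset k) → j ∈ ⁅ i ⁆ △ p → j ≡ i ⊎ j ∈ p
∈-⁅⁆△⁻ {i = zero}  {zero}  _       _          = inj₁ refl
∈-⁅⁆△⁻ {i = zero}  {suc j} (_ ∷ p) (there j∈) = inj₂ (there (subst (j ∈_) (△-identityˡ p) j∈))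
∈-⁅⁆△⁻ {i = suc i} {zero}  (_ ∷ p) here       = inj₂ here
∈-⁅⁆△⁻ {i = suc i} {suc j} (_ ∷ p) (there j∈) with ∈-⁅⁆△⁻ p j∈
... | inj₁ j≡i = inj₁ (cong suc j≡i)
... | inj₂ j∈p = inj₂ (there j∈p)

∉-toSubset : {i : Fin k} (is : Vec (Fin k) m) → All (i ≢_) is → i ∉ toSubset is
∉-toSubset []       []             = ∉⊥
∉-toSubset (j ∷ is) (i≢j ∷ i≢is) i∈ with ∈-⁅⁆△⁻ (toSubset is) i∈
... | inj₁ i≡j = i≢j i≡j
... | inj₂ i∈  = ∉-toSubset is i≢is i∈

∣⁅i⁆△p∣≡1+∣p∣ : (i : Fin k) (p : Subset k) → i ∉ p → ∣ ⁅ i ⁆ △ p ∣ ≡ suc ∣ p ∣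
∣⁅i⁆△p∣≡1+∣p∣ zero    (inside  ∷ p) i∉ = contradiction here i∉
∣⁅i⁆△p∣≡1+∣p∣ zero    (outside ∷ p) _  = cong (suc ∘ ∣_∣) (△-identityˡ p)
∣⁅i⁆△p∣≡1+∣p∣ (suc i) (inside  ∷ p) i∉ = cong suc (∣⁅i⁆△p∣≡1+∣p∣ i p (i∉ ∘ there))
∣⁅i⁆△p∣≡1+∣p∣ (suc i) (outside ∷ p) i∉ = ∣⁅i⁆△p∣≡1+∣p∣ i p (i∉ ∘ there)

∣toSubset∣ : {is : Vec (Fin k) m} → Unique is → ∣ toSubset is ∣ ≡ m
∣toSubset∣ {k = k} []                 = ∣⊥∣≡0 k
∣toSubset∣ {is = i ∷ is} (i≢is ∷ uniq) =
  trans (∣⁅i⁆△p∣≡1+∣p∣ i (toSubset is) (∉-toSubset is i≢is)) (cong suc (∣toSubset∣ uniq))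

enumerate : (p : Subset k) → Σ[ is ∈ Vec (Fin k) ∣ p ∣ ] Unique is × toSubset is ≡ p
enumerate []            = [] , [] , refl
enumerate (outside ∷ p) with enumerate p
... | is , uniq , is↦p =
  map suc is , Unique.map⁺ suc-injective uniq ,
  trans (toSubset-map-suc is) (cong (outside ∷_) is↦p)
enumerate (inside ∷ p)  with enumerate p
... | is , uniq , is↦p =
  zero ∷ map suc is ,
  All.map⁺ (universal (λ _ ()) is) ∷ Unique.map⁺ suc-injective uniq ,
  trans (cong (⁅ zero ⁆ △_) (toSubset-map-suc is))
        (cong (inside ∷_) (trans (△-identityˡ (toSubset is)) is↦p))

enumerate-∣∣≡ : (p : Subset k) → ∣ p ∣ ≡ m → Σ[ is ∈ Vec (Fin k) m ] Unique is × toSubset is ≡ p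
enumerate-∣∣≡ p refl = enumerate p

2∣n⇒n≢0⇒n≢2⇒n≢4⇒6≤n : 2 ∣ n → n ≢ 0 → n ≢ 2 → n ≢ 4 → 6 ≤ n
2∣n⇒n≢0⇒n≢2⇒n≢4⇒6≤n (divides zero                refl) n≢0 _   _   = contradiction refl n≢0
2∣n⇒n≢0⇒n≢2⇒n≢4⇒6≤n (divides (suc zero)          refl) _   n≢2 _   = contradiction refl n≢2
2∣n⇒n≢0⇒n≢2⇒n≢4⇒6≤n (divides (suc (suc zero))    refl) _   _   n≢4 = contradiction refl n≢4
2∣n⇒n≢0⇒n≢2⇒n≢4⇒6≤n (divides (suc (suc (suc q))) refl) _   _   _   = m≤m+n 6 (q * 2)

module _ (S : Fin k → F2^ n) where

  sumOver-pair : (i j : Fin k) → sumOver S (toSubset (i ∷ j ∷ [])) ≡ S i ⊕ S j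
  sumOver-pair i j =
    trans (sumOver-toSubset S (i ∷ j ∷ [])) (cong (S i ⊕_) (⊕-identityʳ (S j)))

  sumOver-quad : (i j l m : Fin k) →
                 sumOver S (toSubset (i ∷ j ∷ l ∷ m ∷ [])) ≡ S i ⊕ S j ⊕ S l ⊕ S m
  sumOver-quad i j l m = begin
    sumOver S (toSubset (i ∷ j ∷ l ∷ m ∷ []))
      ≡⟨ sumOver-toSubset S (i ∷ j ∷ l ∷ m ∷ []) ⟩
    S i ⊕ (S j ⊕ (S l ⊕ (S m ⊕ 𝟎)))
      ≡⟨ cong (λ t → S i ⊕ (S j ⊕ (S l ⊕ t))) (⊕-identityʳ (S m)) ⟩
    S i ⊕ (S j ⊕ (S l ⊕ S m))
      ≡⟨ cong (S i ⊕_) (sym (⊕-assoc (S j) (S l) (S m))) ⟩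
    S i ⊕ (S j ⊕ S l ⊕ S m)
      ≡⟨ sym (⊕-assoc (S i) (S j ⊕ S l) (S m)) ⟩
    S i ⊕ (S j ⊕ S l) ⊕ S m
      ≡⟨ cong (_⊕ S m) (sym (⊕-assoc (S i) (S j) (S l))) ⟩
    S i ⊕ S j ⊕ S l ⊕ S m
      ∎
    where open ≡-Reasoning

  injective⇒sumOver≢𝟎-pair : Injective _≡_ _≡_ S → (p : Subset k) → ∣ p ∣ ≡ 2 → sumOver S p ≢ 𝟎
  injective⇒sumOver≢𝟎-pair S-injective p ∣p∣≡2 with enumerate-∣∣≡ p ∣p∣≡2
  ... | i ∷ j ∷ [] , (i≢j ∷ []) ∷ _ , refl =
    i≢j ∘ S-injective ∘ x⊕y≡𝟎⇒x≡y (S i) (S j) ∘ trans (sym (sumOver-pair i j))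

  isCap⇔sumOver≢𝟎-quad : IsCap S ⇔ (∀ p → ∣ p ∣ ≡ 4 → sumOver S p ≢ 𝟎)
  isCap⇔sumOver≢𝟎-quad = mk⇔ to from
    where
    to : IsCap S → ∀ p → ∣ p ∣ ≡ 4 → sumOver S p ≢ 𝟎
    to cap p ∣p∣≡4 with enumerate-∣∣≡ p ∣p∣≡4
    ... | i ∷ j ∷ l ∷ m ∷ [] ,
          (i≢j ∷ i≢l ∷ i≢m ∷ []) ∷ (j≢l ∷ j≢m ∷ []) ∷ (l≢m ∷ []) ∷ _ , refl =
      cap i j l m i≢j i≢l i≢m j≢l j≢m l≢m ∘ trans (sym (sumOver-quad i j l m))

    from : (∀ p → ∣ p ∣ ≡ 4 → sumOver S p ≢ 𝟎) → IsCap S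
    from quad≢𝟎 i j l m i≢j i≢l i≢m j≢l j≢m l≢m =
      quad≢𝟎 (toSubset (i ∷ j ∷ l ∷ m ∷ [])) (∣toSubset∣ distinct) ∘ trans (sumOver-quad i j l m)
      where
      distinct : Unique (i ∷ j ∷ l ∷ m ∷ [])
      distinct = (i≢j ∷ i≢l ∷ i≢m ∷ []) ∷ (j≢l ∷ j≢m ∷ []) ∷ (l≢m ∷ []) ∷ [] ∷ []

  MinWeight≥6 : Set
  MinWeight≥6 = ∀ p → InE S p → p ≢ ⊥ → 6 ≤ ∣ p ∣

  isCap⇔minWeight≥6 : Injective _≡_ _≡_ S → IsCap S ⇔ MinWeight≥6
  isCap⇔minWeight≥6 S-injective = mk⇔ to from
    where
    open Equivalence isCap⇔sumOver≢𝟎-quad renaming (to to cap⇒quad≢𝟎; from to quad≢𝟎⇒cap)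
    to : IsCap S → MinWeight≥6
    to cap p (2∣∣p∣ , Σp≡𝟎) p≢⊥ = 2∣n⇒n≢0⇒n≢2⇒n≢4⇒6≤n 2∣∣p∣
      (p≢⊥ ∘ ∣p∣≡0⇒p≡⊥ p)
      (λ ∣p∣≡2 → injective⇒sumOver≢𝟎-pair S-injective p ∣p∣≡2 Σp≡𝟎)
      (λ ∣p∣≡4 → cap⇒quad≢𝟎 cap p ∣p∣≡4 Σp≡𝟎)
    from : MinWeight≥6 → IsCap S
    from minWeight≥6 = quad≢𝟎⇒cap quad≢𝟎
      where
      quad≢𝟎 : ∀ p → ∣ p ∣ ≡ 4 → sumOver S p ≢ 𝟎
      quad≢𝟎 p ∣p∣≡4 Σp≡𝟎 = ≤⇒≯ (subst (6 ≤_) ∣p∣≡4 (minWeight≥6 p (2∣∣p∣ , Σp≡𝟎) p≢⊥)) (n≤1+n 5)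
        where
        2∣∣p∣ : 2 ∣ ∣ p ∣
        2∣∣p∣ = subst (2 ∣_) (sym ∣p∣≡4) (divides 2 refl)
        p≢⊥ : p ≢ ⊥
        p≢⊥ p≡⊥ = 0≢1+n (trans (sym (∣⊥∣≡0 k)) (trans (cong ∣_∣ (sym p≡⊥)) ∣p∣≡4))

  minWeight≥6⇔ : {X₁ X₂ : Subset k} → IsBasisE S X₁ X₂ →
                 MinWeight≥6 ⇔ (6 ≤ ∣ X₁ ∣ × 6 ≤ ∣ X₁ △ X₂ ∣ × 6 ≤ ∣ X₂ ∣)
  minWeight≥6⇔ {X₁} {X₂} (X₁∈E , X₂∈E , X₁≢⊥ , X₂≢⊥ , X₁△X₂≢⊥ , span) = mk⇔ to from
    where
    to : MinWeight≥6 → 6 ≤ ∣ X₁ ∣ × 6 ≤ ∣ X₁ △ X₂ ∣ × 6 ≤ ∣ X₂ ∣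
    to minWeight≥6 = minWeight≥6 X₁ X₁∈E X₁≢⊥
                   , minWeight≥6 (X₁ △ X₂) (InE-△ S X₁∈E X₂∈E) X₁△X₂≢⊥
                   , minWeight≥6 X₂ X₂∈E X₂≢⊥
    from : 6 ≤ ∣ X₁ ∣ × 6 ≤ ∣ X₁ △ X₂ ∣ × 6 ≤ ∣ X₂ ∣ → MinWeight≥6
    from (6≤∣X₁∣ , 6≤∣X₁△X₂∣ , 6≤∣X₂∣) p p∈E p≢⊥ with span p p∈E
    ... | inj₁ refl               = contradiction refl p≢⊥
    ... | inj₂ (inj₁ refl)        = 6≤∣X₁∣
    ... | inj₂ (inj₂ (inj₁ refl)) = 6≤∣X₂∣
    ... | inj₂ (inj₂ (inj₂ refl)) = 6≤∣X₁△X₂∣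

lemma6p2 : ∀ (n k d : ℕ) (S : Fin k → F2^ n) → Injective _≡_ _≡_ S →
    AffDim S d → k ≡ d + 3 →
    ∀ (X₁ X₂ : Subset k) → IsBasisE S X₁ X₂ →
    IsCap S ⇔ ((6 ≤ ∣ X₁ ∩ X₂ ∣ + ∣ X₁ ─ X₂ ∣) ×
               (6 ≤ ∣ X₁ ─ X₂ ∣ + ∣ X₂ ─ X₁ ∣) ×
               (6 ≤ ∣ X₁ ∩ X₂ ∣ + ∣ X₂ ─ X₁ ∣))
lemma6p2 n k d S S-injective _ _ X₁ X₂ basis
  rewrite sym (∣p∣≡∣p∩q∣+∣p─q∣ X₁ X₂)
        | sym (∣p△q∣≡∣p─q∣+∣q─p∣ X₁ X₂)
        | sym (∣q∣≡∣p∩q∣+∣q─p∣ X₁ X₂)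
  = minWeight≥6⇔ S basis ⇔-∘ isCap⇔minWeight≥6 S S-injective
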